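{- Let $\Pi\in\mathfrak S(n)$ and let $\mathsf{ct}$ be a corner tree with vertex set $V$. Then the set of occurrences of $\mathsf{ct}$ in $\Pi$ (as maps $V\to[n]$) equals the set $\mathrm{Mor}(D(\mathsf{ct}),\iota(\Pi))$ of double poset morphisms from $D(\mathsf{ct})$ to $\iota(\Pi)$.
   Context: A corner tree is a finite rooted tree with vertex set $V$ whose edges are labeled by one of $\mathsf{NE},\mathsf{NW},\mathsf{SE},\mathsf{SW}$. An occurrence of $\mathsf{ct}$ in $\Pi\in\mathfrak S(n)$ is a map $f:V\to[n]$ such that for every edge $(v,v')$ with $v'$ the child of $v$: if the label is $\mathsf{NE}$ then $f(v')>f(v)$ and $\Pi(f(v'))>\Pi(f(v))$; if $\mathsf{NW}$ then $f(v')<f(v)$ and $\Pi(f(v'))>\Pi(f(v))$; if $\mathsf{SE}$ then $f(v')>f(v)$ and $\Pi(f(v'))<\Pi(f(v))$; if $\mathsf{SW}$ then $f(v')<f(v)$ and $\Pi(f(v'))<\Pi(f(v))$. A finite strict double poset is a triple $(A,P_A,Q_A)$ with $A$ finite and $P_A,Q_A$ strict partial orders on $A$; a morphism $(A,P_A,Q_A)\to(B,P_B,Q_B)$ is a map $f:A\to B$ with $(x,y)\in P_A\Rightarrow(f(x),f(y))\in P_B$ and $(x,y)\in Q_A\Rightarrow(f(x),f(y))\in Q_B$. $D(\mathsf{ct})=(V,<_{\mathrm W},<_{\mathrm S})$ is the double poset where $<_{\mathrm W}$ (resp. $<_{\mathrm S}$) is the transitive closure of the following relation: for each edge from parent $v$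 to child $v'$, put $v<v'$ in the W-relation if the label is $\mathsf{NE}$ or $\mathsf{SE}$, and $v'<v$ if it is $\mathsf{NW}$ or $\mathsf{SW}$; put $v<v'$ in the S-relation if the label is $\mathsf{NE}$ or $\mathsf{NW}$, and $v'<v$ if it is $\mathsf{SE}$ or $\mathsf{SW}$. (This is the twin tree double poset associated to the SN polytree of $\mathsf{ct}$.) For $\Pi\in\mathfrak S(n)$, $\iota(\Pi)=([n],\{(i,j):i<j\},\{(i,j):\Pi(i)<\Pi(j)\})$. -}

module Defs where

open import Data.Nat using (ℕ)
open import Data.Fin using (Fin) renaming (_<_ to _<ᶠ_)
open import Data.List using (List; length; lookup)
open import Data.Product using (_×_; proj₁; proj₂)
open import Data.Fin.Permutation using (Permutation′; _⟨$⟩ʳ_)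
open import Relation.Binary.Construct.Closure.Transitive using (TransClosure)

data Label : Set where
  NE NW SE SW : Label

data CornerTree : Set where
  node : List (Label × CornerTree) → CornerTree

data Vtx : CornerTree → Set where
  root : ∀ {t} → Vtx t
  sub  : ∀ {ts} (i : Fin (length ts)) → Vtx (proj₂ (lookup ts i)) → Vtx (node ts)

data Edge : ∀ {t} → Label → Vtx t → Vtx t → Set where
  top  : ∀ {ts} (i : Fin (length ts)) →
         Edge {node ts} (proj₁ (lookup ts i)) root (sub i root)
  deep : ∀ {ts} (i : Fin (length ts)) {l u v} →
         Edge l u v → Edge {node ts} l (sub i u) (sub i v)

-- Permutations of [n] (0-indexed as Fin n)
Perm : ℕ → Set
Perm n = Permutation′ n

EdgeOK : ∀ {n} → Perm n → Label → Fin n → Fin n → Set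
EdgeOK Π NE a b = (a <ᶠ b) × ((Π ⟨$⟩ʳ a) <ᶠ (Π ⟨$⟩ʳ b))
EdgeOK Π NW a b = (b <ᶠ a) × ((Π ⟨$⟩ʳ a) <ᶠ (Π ⟨$⟩ʳ b))
EdgeOK Π SE a b = (a <ᶠ b) × ((Π ⟨$⟩ʳ b) <ᶠ (Π ⟨$⟩ʳ a))
EdgeOK Π SW a b = (b <ᶠ a) × ((Π ⟨$⟩ʳ b) <ᶠ (Π ⟨$⟩ʳ a))

IsOccurrence : ∀ {n} (ct : CornerTree) → Perm n → (Vtx ct → Fin n) → Set
IsOccurrence ct Π f = ∀ {l} {v v' : Vtx ct} → Edge l v v' → EdgeOK Π l (f v) (f v')

-- A double poset: a carrier with two (strict partial order) relations.
-- (The order axioms play no role in the notion of morphism and are not recorded.)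
record DoublePoset : Set₁ where
  field
    Carrier : Set
    P Q     : Carrier → Carrier → Set

open DoublePoset public

IsMorphism : (A B : DoublePoset) → (Carrier A → Carrier B) → Set
IsMorphism A B f =
  (∀ {x y} → P A x y → P B (f x) (f y)) × (∀ {x y} → Q A x y → Q B (f x) (f y))

data WGen {t : CornerTree} : Vtx t → Vtx t → Set where
  wNE : ∀ {v v'} → Edge NE v v' → WGen v v'
  wSE : ∀ {v v'} → Edge SE v v' → WGen v v'
  wNW : ∀ {v v'} → Edge NW v v' → WGen v' v
  wSW : ∀ {v v'} → Edge SW v v' → WGen v' v

data SGen {t : CornerTree} : Vtx t → Vtx t → Set where
  sNE : ∀ {v v'} → Edge NE v v' → SGen v v'
  sNW : ∀ {v v'} → Edge NW v v' → SGen v v'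
  sSE : ∀ {v v'} → Edge SE v v' → SGen v' v
  sSW : ∀ {v v'} → Edge SW v v' → SGen v' v

D : CornerTree → DoublePoset
D ct = record { Carrier = Vtx ct ; P = TransClosure WGen ; Q = TransClosure SGen }

ι : ∀ {n} → Perm n → DoublePoset
ι {n} Π = record { Carrier = Fin n ; P = _<ᶠ_ ; Q = λ i j → (Π ⟨$⟩ʳ i) <ᶠ (Π ⟨$⟩ʳ j) }

{-# OPTIONS --safe #-}
module Submission where

open import Defs
open import Data.Nat using (ℕ)
open import Data.Fin using (Fin)
open import Data.Fin.Properties using (<-trans)
open import Data.Product using (_×_; _,_; proj₁; proj₂)
open import Level using (Level)
open import Relation.Binary.Core using (Rel; _=[_]⇒_)
open import Relation.Binary.Definitions using (Transitive)
open import Relation.Binary.Construct.Closure.Transitive using (TransClosure; [_]; _∷_)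

-- Each edge contributes one generator to <_W and one to <_S, and the two
-- components of EdgeOK are exactly the images of these generators under f.
-- Hence occurrences are the maps preserving the generators, and since both
-- orders of ι(Π) are transitive, these are the maps preserving their closures.

module _ {a b ℓ₁ ℓ₂ : Level} {A : Set a} {B : Set b}
         {_R_ : Rel A ℓ₁} {_≺_ : Rel B ℓ₂} {f : A → B} where

  TransClosure-preserves : Transitive _≺_ → _R_ =[ f ]⇒ _≺_ → TransClosure _R_ =[ f ]⇒ _≺_
  TransClosure-preserves ≺-trans preserves [ xRy ]      = preserves xRy
  TransClosure-preserves ≺-trans preserves (xRy ∷ yR⁺z) =
    ≺-trans (preserves xRy) (TransClosure-preserves ≺-trans preserves yR⁺z)

module _ {n : ℕ} (Π : Perm n) {ct : CornerTree} {f : Vtx ct → Fin n} where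

  occurrence-preserves-WGen : IsOccurrence ct Π f → WGen =[ f ]⇒ P (ι Π)
  occurrence-preserves-WGen occ (wNE e) = proj₁ (occ e)
  occurrence-preserves-WGen occ (wSE e) = proj₁ (occ e)
  occurrence-preserves-WGen occ (wNW e) = proj₁ (occ e)
  occurrence-preserves-WGen occ (wSW e) = proj₁ (occ e)

  occurrence-preserves-SGen : IsOccurrence ct Π f → SGen =[ f ]⇒ Q (ι Π)
  occurrence-preserves-SGen occ (sNE e) = proj₂ (occ e)
  occurrence-preserves-SGen occ (sNW e) = proj₂ (occ e)
  occurrence-preserves-SGen occ (sSE e) = proj₂ (occ e)
  occurrence-preserves-SGen occ (sSW e) = proj₂ (occ e)

  occurrence⇒morphism : IsOccurrence ct Π f → IsMorphism (D ct) (ι Π) f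
  occurrence⇒morphism occ =
    TransClosure-preserves {_≺_ = P (ι Π)} <-trans (occurrence-preserves-WGen occ) ,
    TransClosure-preserves {_≺_ = Q (ι Π)} <-trans (occurrence-preserves-SGen occ)

  morphism⇒occurrence : IsMorphism (D ct) (ι Π) f → IsOccurrence ct Π f
  morphism⇒occurrence (pW , pS) {NE} e = pW [ wNE e ] , pS [ sNE e ]
  morphism⇒occurrence (pW , pS) {NW} e = pW [ wNW e ] , pS [ sNW e ]
  morphism⇒occurrence (pW , pS) {SE} e = pW [ wSE e ] , pS [ sSE e ]
  morphism⇒occurrence (pW , pS) {SW} e = pW [ wSW e ] , pS [ sSW e ]

proposition2p15 : ∀ {n : ℕ} (Π : Perm n) (ct : CornerTree) (f : Vtx ct → Fin n) →
    (IsOccurrence ct Π f → IsMorphism (D ct) (ι Π) f) × (IsMorphism (D ct) (ι Π) f → IsOccurrence ct Π f)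
proposition2p15 Π ct f = occurrence⇒morphism Π , morphism⇒occurrence Π
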